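{- Let ${\bf n}'=n'_1n'_2\cdots$ be the fixed point of $0\mapsto01$, $1\mapsto2$, $2\mapsto0$ starting with $0$, indexed from $1$. Let $P_i=\{k\ge1: n'_k=i\}$ for $i\in\{0,1,2\}$ and $P_{02}=\{k\ge1:n'_k\in\{0,2\}\}$. For sets $S,T$ let $S+T=\{s+t:s\in S,t\in T\}$. Then: (i) every $n\ge4$ lies in $P_{02}+P_{02}$; (ii) every $n\ge17$ lies in $P_0+P_0$; (iii) for every $i\ge0$, the integer $n=[(100)^i100000]_N$ does not lie in $P_1+P_1$; (iv) every $n\ge27$ lies in $P_1+P_1+P_1$; (v) for every $i\ge1$, the integer $n=[1(00)^i1]_N$ does not lie in $P_2+P_2$; (vi) every $n\ge140$ lies in $P_2+P_2+P_2$.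
   Context: Narayana numbers: $N_0=1,N_1=2,N_2=3$, $N_i=N_{i-1}+N_{i-3}$ for $i\ge3$. For a binary word $w=e_1\cdots e_t$, $[w]_N=\sum_{i=1}^t e_iN_{t-i}$; e.g. $[1001]_N=N_3+N_0=5$. -}

module Defs where

open import Data.Nat using (ℕ; zero; suc; _+_; _*_; _∸_; _≤_)
open import Data.List using (List; []; _∷_; _++_; concatMap; length; replicate; concat)
open import Data.Sum using (_⊎_)
open import Data.Product using (Σ; _×_; ∃-syntax)
open import Relation.Binary.PropositionalEquality using (_≡_)

N : ℕ → ℕ
N 0 = 1
N 1 = 2
N 2 = 3
N (suc (suc (suc i))) = N (suc (suc i)) + N i

[_]N : List ℕ → ℕ
[ [] ]N = 0
[ e ∷ w ]N = e * N (length w) + [ w ]N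

μ : ℕ → List ℕ
μ 0 = 0 ∷ 1 ∷ []
μ 1 = 2 ∷ []
μ _ = 0 ∷ []

μ* : List ℕ → List ℕ
μ* = concatMap μ

iter : ℕ → List ℕ
iter zero = 0 ∷ []
iter (suc k) = μ* (iter k)

at : List ℕ → ℕ → ℕ
at [] _ = 0
at (x ∷ _) zero = x
at (_ ∷ xs) (suc i) = at xs i

-- n'_k for k ≥ 1 : the fixed point of μ starting with 0, indexed from 1.
-- μ^k(0) has length ≥ k+1 and is a prefix of the fixed point, so its
-- (k-1)-th (0-based) letter is n'_k.  (Value at k = 0 is irrelevant.)
n' : ℕ → ℕ
n' k = at (iter k) (k ∸ 1)

P : ℕ → ℕ → Set
P i k = (1 ≤ k) × (n' k ≡ i)

P02 : ℕ → Set
P02 k = (1 ≤ k) × ((n' k ≡ 0) ⊎ (n' k ≡ 2))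

InSum2 : (ℕ → Set) → (ℕ → Set) → ℕ → Set
InSum2 S T n = ∃[ s ] ∃[ t ] (S s × T t × n ≡ s + t)

InSum3 : (ℕ → Set) → (ℕ → Set) → (ℕ → Set) → ℕ → Set
InSum3 S T U n = ∃[ s ] ∃[ t ] ∃[ u ] (S s × T t × U u × n ≡ s + t + u)

pow : List ℕ → ℕ → List ℕ
pow w zero = []
pow w (suc i) = w ++ pow w i

-- The prefixes μᵏ(0) satisfy μᵏ⁺³(0) = μᵏ⁺²(0) μᵏ(0) and |μᵏ(0)| = N_k, so the letter at position
-- N_{k+2} + x equals the letter at x whenever x < N_k, and (applying this twice) the letter at
-- N_{k+4} + x equals the letter at x whenever x < N_{k+2} + N_k.
--
-- Sums covering a half-line: if every m in a window [c, N_{k+4} + c) with c ≤ N_k is x + d with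
-- the letter at x in the wanted class, then so is every m ≥ c.  For larger m pick j ≥ k with
-- N_{j+4} + c ≤ m < N_{j+5} + c; then m − N_{j+4} is represented, its first summand is
-- below N_{j+2} + N_j, and moving it up by N_{j+4} keeps its letter.
--
-- Sums missing a Narayana number: "no a + b + e = N_K with letter c at a and at b" passes from
-- K, K + 3, K + 4 to K + 7.  The larger summand lies in [N_{K+6}, N_{K+7}), in [N_{K+5}, N_{K+6})
-- or below N_{K+5}; in the first two cases subtracting the block start gives a forbidden
-- representation of N_{K+4}, resp. N_{K+5} + N_K (which in turn reduces to N_K, N_{K+3},
-- N_{K+4} the same way), and in the last case the sum is too small.
--
-- The windows and the first seven values of K are checked by evaluation.

module Submission where

open import Defs
open import Data.Nat using (ℕ; _≤_; _+_)
open import Data.List using (List; []; _∷_; _++_)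
open import Data.Product using (_×_)
open import Relation.Nullary using (¬_)

open import Data.Nat
open import Data.Nat.Properties
open import Data.Nat.Induction using (<-rec)
open import Data.Nat.Solver using (module +-*-Solver)
open import Data.List using (length)
open import Data.List.Properties using (concatMap-++; length-++)
open import Data.Maybe using (Maybe; just; nothing; from-just)
import Data.Maybe as Maybe
open import Data.Product using (∃-syntax; _,_)
open import Data.Sum using (_⊎_; inj₁; inj₂; [_,_]′)
open import Relation.Binary.PropositionalEquality
open import Relation.Nullary using (Dec; yes; no; contradiction)
open import Relation.Nullary.Decidable using (toWitness; dec⇒maybe; ¬?; _×-dec_; _⊎-dec_)
open import Relation.Unary using (Decidable)
open +-*-Solver

N-positive : ∀ k → 1 ≤ N k
N-positive 0 = s≤s z≤n
N-positive 1 = s≤s z≤n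
N-positive 2 = s≤s z≤n
N-positive (suc (suc (suc k))) = ≤-trans (N-positive (suc (suc k))) (m≤m+n _ _)

N-<-suc : ∀ k → N k < N (suc k)
N-<-suc 0 = s≤s (s≤s z≤n)
N-<-suc 1 = s≤s (s≤s (s≤s z≤n))
N-<-suc (suc (suc k)) = m<m+n (N (2 + k)) (N-positive k)

N-mono-< : ∀ {j k} → j < k → N j < N k
N-mono-< {j} {suc k} (s≤s j≤k) with m≤n⇒m<n∨m≡n j≤k
... | inj₁ j<k = <-trans (N-mono-< j<k) (N-<-suc k)
... | inj₂ refl = N-<-suc j

N-mono-≤ : ∀ {j k} → j ≤ k → N j ≤ N k
N-mono-≤ j≤k with m≤n⇒m<n∨m≡n j≤k
... | inj₁ j<k = <⇒≤ (N-mono-< j<k)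
... | inj₂ refl = ≤-refl

n<N[n] : ∀ n → n < N n
n<N[n] zero = s≤s z≤n
n<N[n] (suc n) = ≤-<-trans (n<N[n] n) (N-<-suc n)

N-bracket : ∀ k {y} → N k ≤ y → ∃[ j ] k ≤ j × N j ≤ y × y < N (suc j)
N-bracket k {zero} N≤0 = contradiction (≤-trans (N-positive k) N≤0) λ ()
N-bracket k {suc y} N≤1+y with N k ≤? y
... | no N≰y = k , ≤-refl , N≤1+y , <-≤-trans (s≤s (≰⇒> N≰y)) (N-<-suc k)
... | yes N≤y with N-bracket k N≤y
...   | j , k≤j , N≤y' , y<N with suc y <? N (suc j)
...     | yes 1+y<N = j , k≤j , m≤n⇒m≤1+n N≤y' , 1+y<N
...     | no 1+y≮N = suc j , m≤n⇒m≤1+n k≤j , ≮⇒≥ 1+y≮N , <-≤-trans (s≤s y<N) (N-<-suc (suc j))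

-- Letters of the fixed point

iter-recurrence : ∀ k → iter (3 + k) ≡ iter (2 + k) ++ iter k
iter-recurrence zero = refl
iter-recurrence (suc k) =
  trans (cong μ* (iter-recurrence k)) (concatMap-++ μ (iter (2 + k)) (iter k))

length-iter : ∀ k → length (iter k) ≡ N k
length-iter 0 = refl
length-iter 1 = refl
length-iter 2 = refl
length-iter (suc (suc (suc k))) = begin
  length (iter (3 + k))                   ≡⟨ cong length (iter-recurrence k) ⟩
  length (iter (2 + k) ++ iter k)         ≡⟨ length-++ (iter (2 + k)) ⟩
  length (iter (2 + k)) + length (iter k) ≡⟨ cong₂ _+_ (length-iter (suc (suc k))) (length-iter k) ⟩
  N (2 + k) + N k                         ∎
  where open ≡-Reasoning

iter-extends : ∀ k → ∃[ ys ] iter (suc k) ≡ iter k ++ ys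
iter-extends 0 = 1 ∷ [] , refl
iter-extends 1 = 2 ∷ [] , refl
iter-extends (suc (suc k)) = iter k , iter-recurrence k

at-++ˡ : ∀ xs ys {p} → p < length xs → at (xs ++ ys) p ≡ at xs p
at-++ˡ (x ∷ xs) ys {zero} _ = refl
at-++ˡ (x ∷ xs) ys {suc p} (s≤s p<) = at-++ˡ xs ys p<

at-++ʳ : ∀ xs ys p → at (xs ++ ys) (length xs + p) ≡ at ys p
at-++ʳ [] ys p = refl
at-++ʳ (x ∷ xs) ys p = at-++ʳ xs ys p

at-iter-stable : ∀ {k} l {p} → k ≤ l → p < N k → at (iter l) p ≡ at (iter k) p
at-iter-stable l k≤l p< with m≤n⇒m<n∨m≡n k≤l
... | inj₂ refl = refl
at-iter-stable {k} (suc l) {p} _ p< | inj₁ (s≤s k≤l) with iter-extends l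
... | ys , iter-suc = begin
  at (iter (suc l)) p  ≡⟨ cong (λ w → at w p) iter-suc ⟩
  at (iter l ++ ys) p  ≡⟨ at-++ˡ (iter l) ys p<len ⟩
  at (iter l) p        ≡⟨ at-iter-stable l k≤l p< ⟩
  at (iter k) p        ∎
  where
  open ≡-Reasoning
  p<len : p < length (iter l)
  p<len = subst (p <_) (sym (length-iter l)) (<-≤-trans p< (N-mono-≤ k≤l))

-- Positions are 0-based from here on: letter p is n'_{p+1}.
letter : ℕ → ℕ
letter p = n' (suc p)

letter-at : ∀ k {p} → p < N k → letter p ≡ at (iter k) p
letter-at k {p} p< with ≤-total k (suc p)
... | inj₁ k≤1+p = at-iter-stable (suc p) k≤1+p p<
... | inj₂ 1+p≤k = sym (at-iter-stable k 1+p≤k (<-trans (n<1+n p) (n<N[n] (suc p))))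

letter-shift : ∀ k {x} → x < N k → letter (N (2 + k) + x) ≡ letter x
letter-shift k {x} x< = begin
  letter (N (2 + k) + x)                                 ≡⟨ letter-at (3 + k) (+-monoʳ-< (N (2 + k)) x<) ⟩
  at (iter (3 + k)) (N (2 + k) + x)                      ≡⟨ cong (λ w → at w (N (2 + k) + x)) (iter-recurrence k) ⟩
  at (iter (2 + k) ++ iter k) (N (2 + k) + x)
    ≡⟨ cong (λ n → at (iter (2 + k) ++ iter k) (n + x)) (sym (length-iter (2 + k))) ⟩
  at (iter (2 + k) ++ iter k) (length (iter (2 + k)) + x) ≡⟨ at-++ʳ (iter (2 + k)) (iter k) x ⟩
  at (iter k) x                                          ≡⟨ sym (letter-at k x<) ⟩
  letter x                                               ∎
  where open ≡-Reasoning

letter-shift₂ : ∀ k {x} → x < N (2 + k) + N k → letter (N (4 + k) + x) ≡ letter x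
letter-shift₂ k {x} x< with x <? N (2 + k)
... | yes x<N = letter-shift (2 + k) x<N
... | no x≮N = begin
  letter (N (4 + k) + x)               ≡⟨ cong (λ z → letter (N (4 + k) + z)) (sym x≡) ⟩
  letter (N (4 + k) + (N (2 + k) + y)) ≡⟨ cong letter (sym (+-assoc (N (4 + k)) (N (2 + k)) y)) ⟩
  letter (N (5 + k) + y)               ≡⟨ letter-shift (3 + k) (<-≤-trans y<N (N-mono-≤ (m≤n+m k 3))) ⟩
  letter y                             ≡⟨ sym (letter-shift k y<N) ⟩
  letter (N (2 + k) + y)               ≡⟨ cong letter x≡ ⟩
  letter x                             ∎
  where
  open ≡-Reasoning
  y = x ∸ N (2 + k)
  x≡ : N (2 + k) + y ≡ x
  x≡ = m+[n∸m]≡n (≮⇒≥ x≮N)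
  y<N : y < N k
  y<N = +-cancelˡ-< (N (2 + k)) y (N k) (subst (_< N (2 + k) + N k) (sym x≡) x<)

Occ : (ℕ → Set) → ℕ → Set
Occ G p = G (letter p)

-- Sums avoiding a Narayana number

Avoids : ℕ → ℕ → ℕ → Set
Avoids c e T = ∀ a b → Occ (_≡ c) a → Occ (_≡ c) b → a + b + e ≢ T

avoids-if-ordered : ∀ {c e T} → (∀ {a b} → a ≤ b → Occ (_≡ c) a → Occ (_≡ c) b → a + b + e ≢ T) →
                    Avoids c e T
avoids-if-ordered {e = e} avoids≤ a b ca cb with ≤-total a b
... | inj₁ a≤b = avoids≤ a≤b ca cb
... | inj₂ b≤a = λ eq → avoids≤ b≤a cb ca (trans (cong (_+ e) (+-comm b a)) eq)

avoids-if-no-pair-below : ∀ {c e T} → (∀ {a} → a < suc T → ¬ (Occ (_≡ c) a × Occ (_≡ c) (T ∸ e ∸ a))) →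
                          Avoids c e T
avoids-if-no-pair-below {e = e} no-pair a b ca cb refl =
  no-pair (s≤s (≤-trans (m≤m+n a b) (m≤m+n (a + b) e))) (ca , subst (Occ (_≡ _)) (sym b≡) cb)
  where
  b≡ : a + b + e ∸ e ∸ a ≡ b
  b≡ = trans (cong (_∸ a) (m+n∸n≡m (a + b) e)) (m+n∸m≡n a b)

avoids-block : ∀ {c e T} k {a b} → Avoids c e T → N (2 + k) ≤ b → b < N (3 + k) →
               Occ (_≡ c) a → Occ (_≡ c) b → a + b + e ≢ N (2 + k) + T
avoids-block {c} {e} {T} k {a} {b} avoids lo hi ca cb eq = avoids a b′ ca cb′ eq′
  where
  b′ = b ∸ N (2 + k)
  b≡ : N (2 + k) + b′ ≡ b
  b≡ = m+[n∸m]≡n lo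
  b′<N : b′ < N k
  b′<N = +-cancelˡ-< (N (2 + k)) b′ (N k) (subst (_< N (3 + k)) (sym b≡) hi)
  cb′ : Occ (_≡ c) b′
  cb′ = trans (sym (letter-shift k b′<N)) (subst (Occ (_≡ c)) (sym b≡) cb)
  eq′ : a + b′ + e ≡ T
  eq′ = +-cancelˡ-≡ (N (2 + k)) _ _ (begin
    N (2 + k) + (a + b′ + e)
      ≡⟨ solve 4 (λ n a b e → n :+ (a :+ b :+ e) := a :+ (n :+ b) :+ e) refl (N (2 + k)) a b′ e ⟩
    a + (N (2 + k) + b′) + e ≡⟨ cong (λ x → a + x + e) b≡ ⟩
    a + b + e                ≡⟨ eq ⟩
    N (2 + k) + T            ∎)
    where open ≡-Reasoning

sum-below : ∀ {a b e M z} → a ≤ b → b < M → e ≤ z → a + b + e ≢ M + (M + z)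
sum-below {a} {b} {e} {M} {z} a≤b b<M e≤z eq = <-irrefl eq (begin-strict
  a + b + e   <⟨ +-monoˡ-< e (+-mono-< (≤-<-trans a≤b b<M) b<M) ⟩
  M + M + e   ≤⟨ +-monoʳ-≤ (M + M) e≤z ⟩
  M + M + z   ≡⟨ +-assoc M M z ⟩
  M + (M + z) ∎)
  where open ≤-Reasoning

-- N (j + k) as a polynomial in N k, N (1 + k), N (2 + k); it unfolds exactly as N does, so
-- identities between such values are closed by the solver with refl.
Nᵖ : ∀ {n} → ℕ → Polynomial n → Polynomial n → Polynomial n → Polynomial n
Nᵖ 0 x y z = x
Nᵖ 1 x y z = y
Nᵖ 2 x y z = z
Nᵖ (suc (suc (suc j))) x y z = Nᵖ (suc (suc j)) x y z :+ Nᵖ j x y z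

avoids-split : ∀ {c e} k → e ≤ N k →
               Avoids c e (N k) → Avoids c e (N (3 + k)) → Avoids c e (N (4 + k)) → Avoids c e (N (5 + k) + N k)
avoids-split {c} {e} k e≤N avoids₀ avoids₃ avoids₄ = avoids-if-ordered split
  where
  splits-4-3 : N (5 + k) + N k ≡ N (4 + k) + N (3 + k)
  splits-4-3 = solve 3 (λ x y z → Nᵖ 5 x y z :+ x := Nᵖ 4 x y z :+ Nᵖ 3 x y z) refl (N k) (N (1 + k)) (N (2 + k))
  splits-3-3-1 : N (5 + k) + N k ≡ N (3 + k) + (N (3 + k) + N (1 + k))
  splits-3-3-1 =
    solve 3 (λ x y z → Nᵖ 5 x y z :+ x := Nᵖ 3 x y z :+ (Nᵖ 3 x y z :+ y)) refl (N k) (N (1 + k)) (N (2 + k))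
  split : ∀ {a b} → a ≤ b → Occ (_≡ c) a → Occ (_≡ c) b → a + b + e ≢ N (5 + k) + N k
  split {a} {b} a≤b ca cb eq with N (5 + k) ≤? b | N (4 + k) ≤? b | N (3 + k) ≤? b
  ... | yes lo | _ | _ = avoids-block (3 + k) {a} avoids₀ lo b<N ca cb eq
    where
    b<N : b < N (6 + k)
    b<N = begin-strict
      b               ≤⟨ m≤n+m b a ⟩
      a + b           ≤⟨ m≤m+n (a + b) e ⟩
      a + b + e       ≡⟨ eq ⟩
      N (5 + k) + N k <⟨ +-monoʳ-< (N (5 + k)) (N-mono-< {k} {3 + k} (m<n+m k z<s)) ⟩
      N (6 + k)       ∎
      where open ≤-Reasoning
  ... | no b≱ | yes lo | _ = avoids-block (2 + k) {a} avoids₃ lo (≰⇒> b≱) ca cb (trans eq splits-4-3)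
  ... | no _ | no b≱ | yes lo =
    avoids-block (1 + k) {a} avoids₄ lo (≰⇒> b≱) ca cb (trans eq (trans splits-4-3 (+-comm (N (4 + k)) (N (3 + k)))))
  ... | no _ | no _ | no b≱ = sum-below a≤b (≰⇒> b≱) (≤-trans e≤N (N-mono-≤ (n≤1+n k))) (trans eq splits-3-3-1)

avoids-step : ∀ {c e} k → 1 ≤ e → e ≤ N k →
              Avoids c e (N k) → Avoids c e (N (3 + k)) → Avoids c e (N (4 + k)) → Avoids c e (N (7 + k))
avoids-step {c} {e} k 1≤e e≤N avoids₀ avoids₃ avoids₄ = avoids-if-ordered step
  where
  splits-5-5-0 : N (7 + k) ≡ N (5 + k) + (N (5 + k) + N k)
  splits-5-5-0 = solve 3 (λ x y z → Nᵖ 7 x y z := Nᵖ 5 x y z :+ (Nᵖ 5 x y z :+ x)) refl (N k) (N (1 + k)) (N (2 + k))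
  step : ∀ {a b} → a ≤ b → Occ (_≡ c) a → Occ (_≡ c) b → a + b + e ≢ N (7 + k)
  step {a} {b} a≤b ca cb eq with N (6 + k) ≤? b | N (5 + k) ≤? b
  ... | yes lo | _ = avoids-block (4 + k) {a} avoids₄ lo b<N ca cb eq
    where
    b<N : b < N (7 + k)
    b<N = begin-strict
      b         ≤⟨ m≤n+m b a ⟩
      a + b     <⟨ m<m+n (a + b) 1≤e ⟩
      a + b + e ≡⟨ eq ⟩
      N (7 + k) ∎
      where open ≤-Reasoning
  ... | no b≱ | yes lo =
    avoids-block (3 + k) {a} (avoids-split k e≤N avoids₀ avoids₃ avoids₄) lo (≰⇒> b≱) ca cb (trans eq splits-5-5-0)
  ... | no _ | no b≱ = sum-below a≤b (≰⇒> b≱) e≤N (trans eq splits-5-5-0)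

avoids-N : ∀ {c e} m → 1 ≤ e → e ≤ N m → (∀ {k} → k < 7 → Avoids c e (N (k + m))) →
           ∀ {K} → m ≤ K → Avoids c e (N K)
avoids-N {c} {e} m 1≤e e≤N base {K} m≤K =
  subst (λ n → Avoids c e (N n)) (m∸n+n≡m m≤K) (<-rec _ avoids-from (K ∸ m))
  where
  avoids-from : ∀ k → (∀ {j} → j < k → Avoids c e (N (j + m))) → Avoids c e (N (k + m))
  avoids-from k avoids-below with k <? 7
  ... | yes k<7 = base k<7
  ... | no k≮7 with m≤n⇒∃[o]m+o≡n (≮⇒≥ k≮7)
  ...   | o , refl = avoids-step (o + m) 1≤e (≤-trans e≤N (N-mono-≤ (m≤n+m m o)))
    (avoids-below (m<n+m o {7} z<s)) (avoids-below (m<n+m (3 + o) {4} z<s)) (avoids-below (m<n+m (4 + o) {3} z<s))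

-- Sums covering a half-line

N-block : ∀ k S {m} → N (4 + k) + S ≤ m → ∃[ j ] k ≤ j × N (4 + j) + S ≤ m × m < N (5 + j) + S
N-block k S {m} N+S≤m = reindex (N-bracket (4 + k) N≤m∸S)
  where
  m≡ : m ∸ S + S ≡ m
  m≡ = m∸n+n≡m (≤-trans (m≤n+m S _) N+S≤m)
  N≤m∸S : N (4 + k) ≤ m ∸ S
  N≤m∸S = +-cancelʳ-≤ S _ _ (subst (N (4 + k) + S ≤_) (sym m≡) N+S≤m)
  reindex : ∃[ j ] 4 + k ≤ j × N j ≤ m ∸ S × m ∸ S < N (suc j) →
            ∃[ j ] k ≤ j × N (4 + j) + S ≤ m × m < N (5 + j) + S
  reindex (j , 4+k≤j , lo , hi) with m≤n⇒∃[o]m+o≡n 4+k≤j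
  ... | o , refl = k + o , m≤m+n k o ,
    subst (N (4 + k + o) + S ≤_) m≡ (+-monoˡ-≤ S lo) , subst (_< N (5 + k + o) + S) m≡ (+-monoˡ-< S hi)

occ-sum-shift : ∀ {G A : ℕ → Set} j {m} → m < N (2 + j) + N j →
                InSum2 (Occ G) A m → InSum2 (Occ G) A (N (4 + j) + m)
occ-sum-shift {G} j m<N (x , d , Gx , Ad , refl) =
  N (4 + j) + x , d , subst G (sym (letter-shift₂ j (≤-<-trans (m≤m+n x d) m<N))) Gx , Ad ,
  sym (+-assoc (N (4 + j)) x d)

sumset-step : ∀ {G A : ℕ → Set} k {c₀ m} → c₀ ≤ N k → N (4 + k) + c₀ ≤ m →
              (∀ {m′} → m′ < m → c₀ ≤ m′ → InSum2 (Occ G) A m′) → InSum2 (Occ G) A m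
sumset-step {G} {A} k {c₀} {m} c₀≤N big below = from-block (N-block k c₀ big)
  where
  from-block : ∃[ j ] k ≤ j × N (4 + j) + c₀ ≤ m × m < N (5 + j) + c₀ → InSum2 (Occ G) A m
  from-block (j , k≤j , lo , hi) =
    subst (InSum2 (Occ G) A) m≡ (occ-sum-shift {G} {A} j m′<N (below m′<m c₀≤m′))
    where
    m′ = m ∸ N (4 + j)
    m≡ : N (4 + j) + m′ ≡ m
    m≡ = m+[n∸m]≡n (≤-trans (m≤m+n _ c₀) lo)
    c₀≤m′ : c₀ ≤ m′
    c₀≤m′ = +-cancelˡ-≤ (N (4 + j)) _ _ (subst (N (4 + j) + c₀ ≤_) (sym m≡) lo)
    m′<m : m′ < m
    m′<m = subst (m′ <_) m≡ (m<n+m m′ (N-positive (4 + j)))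
    m′<N : m′ < N (2 + j) + N j
    m′<N = begin-strict
      m′               <⟨ +-cancelˡ-< (N (4 + j)) _ _ (subst₂ _<_ (sym m≡) (+-assoc _ (N (2 + j)) c₀) hi) ⟩
      N (2 + j) + c₀   ≤⟨ +-monoʳ-≤ (N (2 + j)) (≤-trans c₀≤N (N-mono-≤ k≤j)) ⟩
      N (2 + j) + N j  ∎
      where open ≤-Reasoning

sumset-extends : ∀ {G A : ℕ → Set} k {c₀} → c₀ ≤ N k →
                 (∀ {m} → m < N (4 + k) + c₀ → c₀ ≤ m → InSum2 (Occ G) A m) →
                 ∀ {m} → c₀ ≤ m → InSum2 (Occ G) A m
sumset-extends {G} {A} k {c₀} c₀≤N base {m} = <-rec (λ m → c₀ ≤ m → InSum2 (Occ G) A m) extend m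
  where
  extend : ∀ m → (∀ {m′} → m′ < m → c₀ ≤ m′ → InSum2 (Occ G) A m′) → c₀ ≤ m → InSum2 (Occ G) A m
  extend m below c₀≤m with m <? N (4 + k) + c₀
  ... | yes m<N = base m<N c₀≤m
  ... | no m≮N = sumset-step {G} {A} k c₀≤N (≮⇒≥ m≮N) below

-- Finite checks

module _ {P : ℕ → Set} (P? : ∀ n → Maybe (P n)) where

  search-below : ∀ v → Maybe (∃[ n ] n < v × P n)
  search-below zero = nothing
  search-below (suc v) with P? v
  ... | just Pv = just (v , n<1+n v , Pv)
  ... | nothing = Maybe.map (λ (n , n<v , Pn) → n , m<n⇒m<1+n n<v , Pn) (search-below v)

  all-below : ∀ v → Maybe (∀ {n} → n < v → P n)
  all-below zero = just λ ()
  all-below (suc v) with P? v | all-below v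
  ... | just Pv | just below =
    just λ n<1+v → [ below , (λ n≡v → subst P (sym n≡v) Pv) ]′ (m<1+n⇒m<n∨m≡n n<1+v)
  ... | _ | _ = nothing

-- The first summand is tried from m downwards, so the second one (the expensive test in the
-- three-fold sums) is tried from 0 upwards.
sum-search : ∀ {A B : ℕ → Set} → (∀ a → Maybe (A a)) → (∀ b → Maybe (B b)) →
             ∀ m → Maybe (InSum2 A B m)
sum-search A? B? m = Maybe.map witness (search-below (λ a → Maybe.zip (A? a) (B? (m ∸ a))) (suc m))
  where
  witness : ∀ {A B : ℕ → Set} → ∃[ a ] a < suc m × A a × B (m ∸ a) → InSum2 A B m
  witness (a , a<1+m , Aa , Bb) = a , m ∸ a , Aa , Bb , sym (m+[n∸m]≡n (≤-pred a<1+m))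

implied-by : ∀ {A B : Set} → Dec A → Maybe B → Maybe (A → B)
implied-by (no ¬a) _ = just (λ a → contradiction a ¬a)
implied-by (yes _) b = Maybe.map (λ b _ → b) b

module LetterTable (ws : List ℕ) (size : ℕ) (agrees : ∀ {p} → p < size → letter p ≡ at ws p) where

  occ? : ∀ {G : ℕ → Set} → Decidable G → ∀ p → Maybe (Occ G p)
  occ? {G} G? p with p <? size
  ... | yes p< = Maybe.map (subst G (sym (agrees p<))) (dec⇒maybe (G? (at ws p)))
  ... | no _ = nothing

  sumset-window : ∀ {G A : ℕ → Set} → Decidable G → (∀ d → Maybe (A d)) → ∀ c₀ B →
                  Maybe (∀ {m} → m < B → c₀ ≤ m → InSum2 (Occ G) A m)
  sumset-window G? A? c₀ B = all-below (λ m → implied-by (c₀ ≤? m) (sum-search (occ? G?) A? m)) B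

-- Handing the prefix μ¹⁸(0) over as an argument makes the evaluator build it once for all lookups.
module Table = LetterTable (iter 18) (N 18) (letter-at 18)

G₀₂ : ℕ → Set
G₀₂ v = v ≡ 0 ⊎ v ≡ 2

no-pair? : ∀ c e T → Dec (∀ {a} → a < suc T → ¬ (Occ (_≡ c) a × Occ (_≡ c) (T ∸ e ∸ a)))
no-pair? c e T = allUpTo? (λ a → ¬? (letter a ≟ c ×-dec letter (T ∸ e ∸ a) ≟ c)) (suc T)

sums-02+02 : ∀ {m} → 2 ≤ m → InSum2 (Occ G₀₂) (Occ G₀₂) m
sums-02+02 = sumset-extends {G₀₂} 1 ≤-refl
  (from-just (Table.sumset-window G₀₂? (Table.occ? G₀₂?) 2 (N 5 + 2)))
  where
  G₀₂? : Decidable G₀₂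
  G₀₂? v = v ≟ 0 ⊎-dec v ≟ 2

sums-0+0 : ∀ {m} → 15 ≤ m → InSum2 (Occ (_≡ 0)) (Occ (_≡ 0)) m
sums-0+0 = sumset-extends {_≡ 0} 7 (≤ᵇ⇒≤ 15 19 _)
  (from-just (Table.sumset-window (_≟ 0) (Table.occ? (_≟ 0)) 15 (N 11 + 15)))

sums-1+1+1 : ∀ {m} → 24 ≤ m → InSum2 (Occ (_≡ 1)) (InSum2 (Occ (_≡ 1)) (Occ (_≡ 1))) m
sums-1+1+1 = sumset-extends {_≡ 1} 8 (≤ᵇ⇒≤ 24 28 _)
  (from-just (Table.sumset-window (_≟ 1) (sum-search occ₁? occ₁?) 24 (N 12 + 24)))
  where
  occ₁? : ∀ p → Maybe (Occ (_≡ 1) p)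
  occ₁? = Table.occ? (_≟ 1)

sums-2+2+2 : ∀ {m} → 137 ≤ m → InSum2 (Occ (_≡ 2)) (InSum2 (Occ (_≡ 2)) (Occ (_≡ 2))) m
sums-2+2+2 = sumset-extends {_≡ 2} 13 (≤ᵇ⇒≤ 137 189 _)
  (from-just (Table.sumset-window (_≟ 2) (sum-search occ₂? occ₂?) 137 (N 17 + 137)))
  where
  occ₂? : ∀ p → Maybe (Occ (_≡ 2) p)
  occ₂? = Table.occ? (_≟ 2)

avoids-1-6 : ∀ {K} → 4 ≤ K → Avoids 1 6 (N K)
avoids-1-6 = avoids-N {1} {6} 4 (s≤s z≤n) ≤-refl
  (λ k<7 → avoids-if-no-pair-below (toWitness {a? = allUpTo? (λ k → no-pair? 1 6 (N (k + 4))) 7} _ k<7))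

avoids-2-1 : ∀ K → Avoids 2 1 (N K)
avoids-2-1 K = avoids-N {2} {1} 0 ≤-refl ≤-refl
  (λ k<7 → avoids-if-no-pair-below (toWitness {a? = allUpTo? (λ k → no-pair? 2 1 (N (k + 0))) 7} _ k<7)) {K} z≤n

-- P c and P02 of the statement are Occ₁ (_≡ c) and Occ₁ G₀₂ by definition.
Occ₁ : (ℕ → Set) → ℕ → Set
Occ₁ G k = 1 ≤ k × G (n' k)

one-based₂ : ∀ {G H : ℕ → Set} {m} → InSum2 (Occ G) (Occ H) m → InSum2 (Occ₁ G) (Occ₁ H) (2 + m)
one-based₂ (x , y , Gx , Hy , refl) = suc x , suc y , (s≤s z≤n , Gx) , (s≤s z≤n , Hy) , cong suc (sym (+-suc x y))

one-based₃ : ∀ {G : ℕ → Set} {m} → InSum2 (Occ G) (InSum2 (Occ G) (Occ G)) m →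
             InSum3 (Occ₁ G) (Occ₁ G) (Occ₁ G) (3 + m)
one-based₃ (x , d , Gx , (a , b , Ga , Gb , refl) , refl) =
  suc a , suc b , suc x , (s≤s z≤n , Ga) , (s≤s z≤n , Gb) , (s≤s z≤n , Gx) ,
  solve 3 (λ x a b → con 3 :+ (x :+ (a :+ b)) := con 1 :+ a :+ (con 1 :+ b) :+ (con 1 :+ x)) refl x a b

half-line₂ : ∀ {G H : ℕ → Set} c → (∀ {m} → c ≤ m → InSum2 (Occ G) (Occ H) m) →
             ∀ n → 2 + c ≤ n → InSum2 (Occ₁ G) (Occ₁ H) n
half-line₂ {G} {H} c sums n 2+c≤n =
  subst (InSum2 (Occ₁ G) (Occ₁ H)) (m+[n∸m]≡n (≤-trans (m≤m+n 2 c) 2+c≤n))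
    (one-based₂ {G} {H} (sums (∸-monoˡ-≤ 2 2+c≤n)))

half-line₃ : ∀ {G : ℕ → Set} c → (∀ {m} → c ≤ m → InSum2 (Occ G) (InSum2 (Occ G) (Occ G)) m) →
             ∀ n → 3 + c ≤ n → InSum3 (Occ₁ G) (Occ₁ G) (Occ₁ G) n
half-line₃ {G} c sums n 3+c≤n =
  subst (InSum3 (Occ₁ G) (Occ₁ G) (Occ₁ G)) (m+[n∸m]≡n (≤-trans (m≤m+n 3 c) 3+c≤n))
    (one-based₃ {G} (sums (∸-monoˡ-≤ 3 3+c≤n)))

avoids-one-based : ∀ {c e T n} → Avoids c e T → n + e ≡ 2 + T → ¬ InSum2 (Occ₁ (_≡ c)) (Occ₁ (_≡ c)) n
avoids-one-based avoids eq (zero , _ , (() , _) , _)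
avoids-one-based avoids eq (suc a , zero , _ , (() , _) , _)
avoids-one-based {e = e} avoids eq (suc a , suc b , (_ , ca) , (_ , cb) , refl) =
  avoids a b ca cb (+-cancelˡ-≡ 2 _ _ (trans shuffle eq))
  where
  shuffle : 2 + (a + b + e) ≡ suc a + suc b + e
  shuffle = solve 3 (λ a b e → con 2 :+ (a :+ b :+ e) := con 1 :+ a :+ (con 1 :+ b) :+ e) refl a b e

[1∷w]N : ∀ w → [ 1 ∷ w ]N ≡ N (length w) + [ w ]N
[1∷w]N w = cong (_+ [ w ]N) (*-identityˡ (N (length w)))

length-pow : ∀ w i → length (pow w i) ≡ i * length w
length-pow w zero = refl
length-pow w (suc i) = trans (length-++ w) (cong (length w +_) (length-pow w i))

[100ⁱ100000]N : ∀ i → [ pow (1 ∷ 0 ∷ 0 ∷ []) i ++ (1 ∷ 0 ∷ 0 ∷ 0 ∷ 0 ∷ 0 ∷ []) ]N + 4 ≡ N (6 + i * 3)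
[100ⁱ100000]N zero = refl
[100ⁱ100000]N (suc i) = begin
  [ 1 ∷ 0 ∷ 0 ∷ w ]N + 4                 ≡⟨ cong (_+ 4) ([1∷w]N (0 ∷ 0 ∷ w)) ⟩
  N (2 + length w) + [ w ]N + 4          ≡⟨ cong (λ l → N (2 + l) + [ w ]N + 4) length-w ⟩
  N (8 + i * 3) + [ w ]N + 4             ≡⟨ +-assoc (N (8 + i * 3)) [ w ]N 4 ⟩
  N (8 + i * 3) + ([ w ]N + 4)           ≡⟨ cong (N (8 + i * 3) +_) ([100ⁱ100000]N i) ⟩
  N (8 + i * 3) + N (6 + i * 3)          ∎
  where
  open ≡-Reasoning
  w = pow (1 ∷ 0 ∷ 0 ∷ []) i ++ (1 ∷ 0 ∷ 0 ∷ 0 ∷ 0 ∷ 0 ∷ [])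
  length-w : length w ≡ 6 + i * 3
  length-w = trans (length-++ (pow (1 ∷ 0 ∷ 0 ∷ []) i)) (trans (cong (_+ 6) (length-pow _ i)) (+-comm (i * 3) 6))

[00ⁱ1]N : ∀ i → [ pow (0 ∷ 0 ∷ []) i ++ (1 ∷ []) ]N ≡ 1
[00ⁱ1]N zero = refl
[00ⁱ1]N (suc i) = [00ⁱ1]N i

P1+P1-misses : (i : ℕ) → ¬ InSum2 (P 1) (P 1) [ pow (1 ∷ 0 ∷ 0 ∷ []) i ++ (1 ∷ 0 ∷ 0 ∷ 0 ∷ 0 ∷ 0 ∷ []) ]N
P1+P1-misses i = avoids-one-based (avoids-1-6 (m≤m+n 4 (2 + i * 3))) (begin
  n + 6             ≡⟨ +-comm n 6 ⟩
  2 + (4 + n)       ≡⟨ cong (2 +_) (+-comm 4 n) ⟩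
  2 + (n + 4)       ≡⟨ cong (2 +_) ([100ⁱ100000]N i) ⟩
  2 + N (6 + i * 3) ∎)
  where
  open ≡-Reasoning
  n = [ pow (1 ∷ 0 ∷ 0 ∷ []) i ++ (1 ∷ 0 ∷ 0 ∷ 0 ∷ 0 ∷ 0 ∷ []) ]N

P2+P2-misses : (i : ℕ) → 1 ≤ i → ¬ InSum2 (P 2) (P 2) [ (1 ∷ []) ++ pow (0 ∷ 0 ∷ []) i ++ (1 ∷ []) ]N
P2+P2-misses i _ = avoids-one-based (avoids-2-1 (length w)) (begin
  [ 1 ∷ w ]N + 1            ≡⟨ cong (_+ 1) ([1∷w]N w) ⟩
  N (length w) + [ w ]N + 1 ≡⟨ cong (λ v → N (length w) + v + 1) ([00ⁱ1]N i) ⟩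
  N (length w) + 1 + 1      ≡⟨ +-comm (N (length w) + 1) 1 ⟩
  suc (N (length w) + 1)    ≡⟨ cong suc (+-comm (N (length w)) 1) ⟩
  2 + N (length w)          ∎)
  where
  open ≡-Reasoning
  w = pow (0 ∷ 0 ∷ []) i ++ (1 ∷ [])

theorem22 :
    ((n : ℕ) → 4 ≤ n → InSum2 P02 P02 n)
    × ((n : ℕ) → 17 ≤ n → InSum2 (P 0) (P 0) n)
    × ((i : ℕ) → ¬ InSum2 (P 1) (P 1) [ pow (1 ∷ 0 ∷ 0 ∷ []) i ++ (1 ∷ 0 ∷ 0 ∷ 0 ∷ 0 ∷ 0 ∷ []) ]N)
    × ((n : ℕ) → 27 ≤ n → InSum3 (P 1) (P 1) (P 1) n)
    × ((i : ℕ) → 1 ≤ i → ¬ InSum2 (P 2) (P 2) [ (1 ∷ []) ++ pow (0 ∷ 0 ∷ []) i ++ (1 ∷ []) ]N)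
    × ((n : ℕ) → 140 ≤ n → InSum3 (P 2) (P 2) (P 2) n)
theorem22 =
  half-line₂ {G₀₂} {G₀₂} 2 sums-02+02 ,
  half-line₂ {_≡ 0} {_≡ 0} 15 sums-0+0 ,
  P1+P1-misses ,
  half-line₃ {_≡ 1} 24 sums-1+1+1 ,
  P2+P2-misses ,
  half-line₃ {_≡ 2} 137 sums-2+2+2
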